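{- In 8-move peg solitaire on $Diamond(3)$, the central game (start with every hole occupied except the center $c3$, finish with a single peg at $c3$) is solvable, and the minimum number of moves in a solution is exactly 7.
   Context: $Diamond(3)$ has columns a–e ($x=1,\dots,5$) and rows 1–5 ($y=1,\dots,5$), consisting of the 13 holes $(x,y)$ with $|x-3|+|y-3|\le 2$; its center is $c3$. Each hole is empty or holds one peg. In 8-move solitaire a jump takes a peg at hole $p$, with hole $p+v$ occupied and $p+2v$ empty, where $v$ is one of the 8 horizontal, vertical or diagonal unit steps and all three holes lie on the board; the peg moves to $p+2v$ and the peg at $p+v$ is removed. A move is a maximal sequence of one or more consecutive jumps made by the same peg. -}

module Defs where

open import Data.Bool using (Bool; true; false; if_then_else_)
open import Data.Nat using (ℕ; zero; suc; _+_; _≤_)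
open import Data.Integer as ℤ using (ℤ; +_; -[1+_]; ∣_∣; _-_)
import Data.Integer.Properties as ℤP
open import Data.Product using (_×_; _,_; proj₁; proj₂)
open import Data.Product.Properties using (≡-dec)
open import Data.Maybe using (Maybe; just; nothing)
open import Relation.Nullary using (Dec; yes; no; does)
open import Relation.Binary.PropositionalEquality using (_≡_)

-- A hole (x , y): column x (a=1,…,e=5), row y (1,…,5).
Hole : Set
Hole = ℤ × ℤ

_≟H_ : (p q : Hole) → Dec (p ≡ q)
_≟H_ = ≡-dec ℤP._≟_ ℤP._≟_

OnBoard : Hole → Set
OnBoard (x , y) = ∣ x - + 3 ∣ + ∣ y - + 3 ∣ ≤ 2

center : Hole
center = (+ 3 , + 3)

data Dir : Set where
  E W N S NE NW SE SW : Dir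

vec : Dir → ℤ × ℤ
vec E  = (+ 1 , + 0)
vec W  = (-[1+ 0 ] , + 0)
vec N  = (+ 0 , + 1)
vec S  = (+ 0 , -[1+ 0 ])
vec NE = (+ 1 , + 1)
vec NW = (-[1+ 0 ] , + 1)
vec SE = (+ 1 , -[1+ 0 ])
vec SW = (-[1+ 0 ] , -[1+ 0 ])

_⊕_ : Hole → Dir → Hole
(x , y) ⊕ d = (x ℤ.+ proj₁ (vec d) , y ℤ.+ proj₂ (vec d))

-- A board position: true = hole holds a peg.  Only values on the board matter.
State : Set
State = Hole → Bool

_≈_ : State → State → Set
s ≈ t = ∀ q → OnBoard q → s q ≡ t q

after : State → Hole → Dir → State
after s p d q with does (q ≟H p) | does (q ≟H (p ⊕ d)) | does (q ≟H ((p ⊕ d) ⊕ d))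
... | true  | _     | _     = false
... | false | true  | _     = false
... | false | false | true  = true
... | false | false | false = s q

record Jump (s : State) (p : Hole) (d : Dir) (t : State) : Set where
  field
    onP    : OnBoard p
    onMid  : OnBoard (p ⊕ d)
    onTo   : OnBoard ((p ⊕ d) ⊕ d)
    pegP   : s p ≡ true
    pegMid : s (p ⊕ d) ≡ true
    empty  : s ((p ⊕ d) ⊕ d) ≡ false
    result : t ≈ after s p d

data Play : State → State → Set where
  done : ∀ {s t} → s ≈ t → Play s t
  step : ∀ {s u t} (p : Hole) (d : Dir) → Jump s p d u → Play u t → Play s t

-- Number of moves: a move is a maximal run of consecutive jumps by the same peg,
-- i.e. a new move starts exactly when a jump does not start at the landing hole
-- of the previous jump.
movesFrom : ∀ {s t} → Maybe Hole → Play s t → ℕ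
movesFrom prev (done _) = 0
movesFrom nothing (step p d _ rest) = suc (movesFrom (just ((p ⊕ d) ⊕ d)) rest)
movesFrom (just l) (step p d _ rest) with does (l ≟H p)
... | true  = movesFrom (just ((p ⊕ d) ⊕ d)) rest
... | false = suc (movesFrom (just ((p ⊕ d) ⊕ d)) rest)

moves : ∀ {s t} → Play s t → ℕ
moves = movesFrom nothing

startState : State
startState q = if does (q ≟H center) then false else true

finishState : State
finishState q = does (q ≟H center)

-- The upper bound is an explicit seven-move solution, replayed and checked by evaluation.
-- For the lower bound, a play is tracked on the 13 cells of the board together with the
-- landing hole of its last jump, since a jump from that hole continues the current move
-- for free.  An exhaustive search over such configurations is complete for plays of at
-- most k moves, and for k = 6 it finds none from the central starting position.
module Submission where

open import Defs
open import Data.Bool using (Bool; true; false; T; not; _∧_; _∨_; if_then_else_)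
open import Data.Bool.Properties using (T-∧; T-∨; T-≡)
import Data.Bool.Properties as Bool
open import Data.Bool.ListAction using (any)
open import Data.Nat using (ℕ; zero; suc; _+_; _∸_; _≤_; _<_; _≤?_; _≤ᵇ_; s≤s)
open import Data.Nat.Properties using (≤⇒≤ᵇ; m+n≤o⇒m≤o; m+n≤o⇒n≤o; m+n≤o⇒m≤o∸n; +-comm; ≰⇒>)
open import Data.Integer using (+_; -[1+_]; ∣_∣; _-_)
open import Data.Fin using (Fin; toℕ; #_)
open import Data.Fin.Properties using (all?; any?) renaming (_≟_ to _≟C_)
open import Data.Product using (Σ; ∃; _×_; _,_)
import Data.Product.Properties as Product
open import Data.Sum using (inj₁; inj₂)
open import Data.Maybe as Maybe using (Maybe; just; nothing; from-just)
open import Data.List using (List; []; _∷_)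
import Data.List.Relation.Unary.Any as Any
open import Data.List.Relation.Unary.Any.Properties using (any⁺)
open import Data.List.Membership.Propositional using (_∈_)
open import Data.List.Membership.DecPropositional
  (Product.≡-dec (_≟C_ {13}) (Product.≡-dec (_≟C_ {13}) (_≟C_ {13}))) using (_∈?_)
open import Data.Vec using (Vec; tabulate; lookup)
open import Data.Vec.Properties using (tabulate-cong; lookup∘tabulate)
import Data.Vec.Properties as Vec
open import Function using (_∘_; Equivalence)
open import Relation.Nullary using (Dec; does; _×-dec_; _→-dec_)
open import Relation.Nullary.Decidable using (from-yes; map′; dec⇒maybe; dec-true)
open import Relation.Binary.PropositionalEquality
  using (_≡_; refl; sym; trans; cong; cong₂; subst; module ≡-Reasoning)

Cell : Set
Cell = Fin 13

pattern c1 = Fin.zero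
pattern b2 = Fin.suc c1
pattern c2 = Fin.suc b2
pattern d2 = Fin.suc c2
pattern a3 = Fin.suc d2
pattern b3 = Fin.suc a3
pattern c3 = Fin.suc b3
pattern d3 = Fin.suc c3
pattern e3 = Fin.suc d3
pattern b4 = Fin.suc e3
pattern c4 = Fin.suc b4
pattern d4 = Fin.suc c4
pattern c5 = Fin.suc d4

pos : Cell → Hole
pos c1 = + 3 , + 1
pos b2 = + 2 , + 2
pos c2 = + 3 , + 2
pos d2 = + 4 , + 2
pos a3 = + 1 , + 3
pos b3 = + 2 , + 3
pos c3 = + 3 , + 3
pos d3 = + 4 , + 3
pos e3 = + 5 , + 3
pos b4 = + 2 , + 4
pos c4 = + 3 , + 4
pos d4 = + 4 , + 4
pos c5 = + 3 , + 5

onBoard? : ∀ q → Dec (OnBoard q)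
onBoard? (x , y) = _ ≤? 2

pos-onBoard : ∀ c → OnBoard (pos c)
pos-onBoard = from-yes (all? λ c → onBoard? (pos c))

coordinate-range : ∀ x → ∣ x - + 3 ∣ ≤ 2 → ∃ λ (i : Fin 5) → x ≡ + suc (toℕ i)
coordinate-range -[1+ 0 ]     (s≤s (s≤s ()))
coordinate-range -[1+ suc _ ] (s≤s (s≤s ()))
coordinate-range (+ 0)        (s≤s (s≤s ()))
coordinate-range (+ 1)        _ = # 0 , refl
coordinate-range (+ 2)        _ = # 1 , refl
coordinate-range (+ 3)        _ = # 2 , refl
coordinate-range (+ 4)        _ = # 3 , refl
coordinate-range (+ 5)        _ = # 4 , refl
coordinate-range (+ suc (suc (suc (suc (suc (suc _)))))) (s≤s (s≤s ()))

cellOf : ∀ q → OnBoard q → ∃ λ c → pos c ≡ q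
cellOf (x , y) onq
  with coordinate-range x (m+n≤o⇒m≤o _ onq) | coordinate-range y (m+n≤o⇒n≤o _ onq)
... | i , refl | j , refl = boxCells i j onq
  where
  box : Fin 5 → Fin 5 → Hole
  box i j = + suc (toℕ i) , + suc (toℕ j)
  boxCells : ∀ i j → OnBoard (box i j) → ∃ λ c → pos c ≡ box i j
  boxCells = from-yes (all? λ i → all? λ j →
    onBoard? (box i j) →-dec any? λ c → pos c ≟H box i j)

Line : Set
Line = Cell × Cell × Cell

AlongDir : Dir → Line → Set
AlongDir d (f , o , t) = pos o ≡ pos f ⊕ d × pos t ≡ pos o ⊕ d

jumps : List Line
jumps =
  (c1 , c2 , c3) ∷ (c1 , d2 , e3) ∷ (c1 , b2 , a3) ∷
  (b2 , c2 , d2) ∷ (b2 , b3 , b4) ∷ (b2 , c3 , d4) ∷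
  (c2 , c3 , c4) ∷
  (d2 , c2 , b2) ∷ (d2 , d3 , d4) ∷ (d2 , c3 , b4) ∷
  (a3 , b3 , c3) ∷ (a3 , b4 , c5) ∷ (a3 , b2 , c1) ∷
  (b3 , c3 , d3) ∷
  (c3 , d3 , e3) ∷ (c3 , b3 , a3) ∷ (c3 , c4 , c5) ∷ (c3 , c2 , c1) ∷
  (d3 , c3 , b3) ∷
  (e3 , d3 , c3) ∷ (e3 , d4 , c5) ∷ (e3 , d2 , c1) ∷
  (b4 , c4 , d4) ∷ (b4 , b3 , b2) ∷ (b4 , c3 , d2) ∷
  (c4 , c3 , c2) ∷
  (d4 , c4 , b4) ∷ (d4 , d3 , d2) ∷ (d4 , c3 , b2) ∷
  (c5 , c4 , c3) ∷ (c5 , d4 , e3) ∷ (c5 , b4 , a3) ∷ []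

jumpsAlong? : ∀ d → Dec (∀ f o t → AlongDir d (f , o , t) → (f , o , t) ∈ jumps)
jumpsAlong? d = all? λ f → all? λ o → all? λ t →
  (pos o ≟H (pos f ⊕ d) ×-dec pos t ≟H (pos o ⊕ d)) →-dec (f , o , t) ∈? jumps

jumps-complete : ∀ d f o t → AlongDir d (f , o , t) → (f , o , t) ∈ jumps
jumps-complete E  = from-yes (jumpsAlong? E)
jumps-complete W  = from-yes (jumpsAlong? W)
jumps-complete N  = from-yes (jumpsAlong? N)
jumps-complete S  = from-yes (jumpsAlong? S)
jumps-complete NE = from-yes (jumpsAlong? NE)
jumps-complete NW = from-yes (jumpsAlong? NW)
jumps-complete SE = from-yes (jumpsAlong? SE)
jumps-complete SW = from-yes (jumpsAlong? SW)

Board : Set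
Board = Vec Bool 13

board : State → Board
board s = tabulate (s ∘ pos)

_≟B_ : (b b′ : Board) → Dec (b ≡ b′)
_≟B_ = Vec.≡-dec Bool._≟_

≈⇒board≡ : ∀ {s t} → s ≈ t → board s ≡ board t
≈⇒board≡ s≈t = tabulate-cong λ c → s≈t (pos c) (pos-onBoard c)

board≡⇒≈ : ∀ {s t} → board s ≡ board t → s ≈ t
board≡⇒≈ {s} {t} eq q onq with cellOf q onq
... | c , refl = begin
  s (pos c)          ≡⟨ lookup∘tabulate (s ∘ pos) c ⟨
  lookup (board s) c ≡⟨ cong (λ b → lookup b c) eq ⟩
  lookup (board t) c ≡⟨ lookup∘tabulate (t ∘ pos) c ⟩
  t (pos c)          ∎
  where open ≡-Reasoning

legal : Line → Board → Bool
legal (f , o , t) b = lookup b f ∧ lookup b o ∧ not (lookup b t)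

legal-board : ∀ s f o t → s (pos f) ≡ true → s (pos o) ≡ true → s (pos t) ≡ false
  → T (legal (f , o , t) (board s))
legal-board s f o t peg-f peg-o empty-t
  rewrite lookup∘tabulate (s ∘ pos) f | lookup∘tabulate (s ∘ pos) o | lookup∘tabulate (s ∘ pos) t
        | peg-f | peg-o | empty-t = _

jumpUpdate : (from over to q : Hole) → Bool → Bool
jumpUpdate from over to q old =
  if does (q ≟H from) then false else
  if does (q ≟H over) then false else
  if does (q ≟H to) then true else old

after-jumpUpdate : ∀ s p d q → after s p d q ≡ jumpUpdate p (p ⊕ d) ((p ⊕ d) ⊕ d) q (s q)
after-jumpUpdate s p d q with does (q ≟H p) | does (q ≟H (p ⊕ d)) | does (q ≟H ((p ⊕ d) ⊕ d))
... | true  | _     | _     = refl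
... | false | true  | _     = refl
... | false | false | true  = refl
... | false | false | false = refl

applyLine : Line → Board → Board
applyLine (f , o , t) b = tabulate λ c → jumpUpdate (pos f) (pos o) (pos t) (pos c) (lookup b c)

board-after : ∀ s d f o t → AlongDir d (f , o , t)
  → board (after s (pos f) d) ≡ applyLine (f , o , t) (board s)
board-after s d f o t (o≡ , t≡) = tabulate-cong λ c → begin
  after s (pos f) d (pos c)
    ≡⟨ after-jumpUpdate s (pos f) d (pos c) ⟩
  jumpUpdate (pos f) (pos f ⊕ d) ((pos f ⊕ d) ⊕ d) (pos c) (s (pos c))
    ≡⟨ cong₂ (λ over to → jumpUpdate (pos f) over to (pos c) (s (pos c))) o≡ landing ⟨
  jumpUpdate (pos f) (pos o) (pos t) (pos c) (s (pos c))
    ≡⟨ cong (jumpUpdate (pos f) (pos o) (pos t) (pos c)) (lookup∘tabulate (s ∘ pos) c) ⟨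
  jumpUpdate (pos f) (pos o) (pos t) (pos c) (lookup (board s) c) ∎
  where
  open ≡-Reasoning
  landing : pos t ≡ (pos f ⊕ d) ⊕ d
  landing = trans t≡ (cong (_⊕ d) o≡)

moveCost : Maybe Hole → Hole → ℕ
moveCost nothing     _ = 1
moveCost (just land) p = if does (land ≟H p) then 0 else 1

movesFrom-step : ∀ last {s u t} p d (J : Jump s p d u) (rest : Play u t)
  → movesFrom last (step p d J rest) ≡ moveCost last p + movesFrom (just ((p ⊕ d) ⊕ d)) rest
movesFrom-step nothing     p d J rest = refl
movesFrom-step (just land) p d J rest with does (land ≟H p)
... | true  = refl
... | false = refl

isFinished : Board → Bool
isFinished b = does (b ≟B board finishState)

-- Running out of fuel answers true, so the search can only over-approximate.
mutual
  finishable : (fuel k : ℕ) → Maybe Hole → Board → Bool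
  finishable zero       _ _    _ = true
  finishable (suc fuel) k last b = isFinished b ∨ any (finishableVia fuel k last b) jumps

  finishableVia : (fuel k : ℕ) → Maybe Hole → Board → Line → Bool
  finishableVia fuel k last b j@(f , _ , t) =
    legal j b ∧ (cost ≤ᵇ k) ∧ finishable fuel (k ∸ cost) (just (pos t)) (applyLine j b)
    where cost = moveCost last (pos f)

finishable-done : ∀ fuel k last b → b ≡ board finishState → T (finishable (suc fuel) k last b)
finishable-done fuel k last b b≡ = Equivalence.from (T-∨ {isFinished b})
  (inj₁ (Equivalence.from T-≡ (dec-true (b ≟B board finishState) b≡)))

finishable-step : ∀ fuel k last b f o t → (f , o , t) ∈ jumps → T (legal (f , o , t) b)
  → moveCost last (pos f) ≤ k
  → T (finishable fuel (k ∸ moveCost last (pos f)) (just (pos t)) (applyLine (f , o , t) b))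
  → T (finishable (suc fuel) k last b)
finishable-step fuel k last b f o t j∈ isLegal affordable rest =
  Equivalence.from (T-∨ {isFinished b})
    (inj₂ (any⁺ (finishableVia fuel k last b) (Any.map (λ { refl → via }) j∈)))
  where
  via : T (finishableVia fuel k last b (f , o , t))
  via = Equivalence.from (T-∧ {legal (f , o , t) b})
    (isLegal , Equivalence.from T-∧ (≤⇒≤ᵇ affordable , rest))

play⇒finishable : ∀ fuel k last {s t} (play : Play s t)
  → t ≈ finishState → movesFrom last play ≤ k → T (finishable fuel k last (board s))
play⇒finishable zero       _ _    _    _   _     = _
play⇒finishable (suc fuel) k last {s} (done s≈t) fin bound =
  finishable-done fuel k last (board s) (≈⇒board≡ λ q onq → trans (s≈t q onq) (fin q onq))
play⇒finishable (suc fuel) k last {s} (step p d J rest) fin bound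
  with cellOf p (Jump.onP J) | cellOf (p ⊕ d) (Jump.onMid J) | cellOf ((p ⊕ d) ⊕ d) (Jump.onTo J)
... | f , refl | o , o≡ | t , t≡ =
  finishable-step fuel k last (board s) f o t (jumps-complete d f o t along)
    isLegal (m+n≤o⇒m≤o cost bound′) continue
  where
  isLegal : T (legal (f , o , t) (board s))
  isLegal = legal-board s f o t (Jump.pegP J)
    (trans (cong s o≡) (Jump.pegMid J)) (trans (cong s t≡) (Jump.empty J))
  along : AlongDir d (f , o , t)
  along = o≡ , trans t≡ (cong (_⊕ d) (sym o≡))
  cost : ℕ
  cost = moveCost last (pos f)
  bound′ : cost + movesFrom (just (pos t)) rest ≤ k
  bound′ = subst (λ land → cost + movesFrom (just land) rest ≤ k) (sym t≡)
                 (subst (_≤ k) (movesFrom-step last (pos f) d J rest) bound)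
  continue : T (finishable fuel (k ∸ cost) (just (pos t)) (applyLine (f , o , t) (board s)))
  continue = subst (T ∘ finishable fuel (k ∸ cost) (just (pos t)))
    (trans (≈⇒board≡ (Jump.result J)) (board-after s d f o t along))
    (play⇒finishable fuel (k ∸ cost) (just (pos t)) rest fin
      (m+n≤o⇒m≤o∸n _ (subst (_≤ k) (+-comm cost _) bound′)))

unfinishable⇒moves> : ∀ fuel k {s} → finishable fuel k nothing (board s) ≡ false
  → (play : Play s finishState) → k < moves play
unfinishable⇒moves> fuel k unfinishable play = ≰⇒> λ moves≤k →
  subst T unfinishable (play⇒finishable fuel k nothing play (λ _ _ → refl) moves≤k)

-- Each jump removes a peg, so a play from the 12-peg start has at most 11 jumps.
sixMovesUnfinishable : finishable 12 6 nothing (board startState) ≡ false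
sixMovesUnfinishable = refl

jump? : ∀ s p d → Dec (Jump s p d (after s p d))
jump? s p d = map′ toJump fromJump
  (onBoard? p ×-dec onBoard? (p ⊕ d) ×-dec onBoard? ((p ⊕ d) ⊕ d) ×-dec
   s p Bool.≟ true ×-dec s (p ⊕ d) Bool.≟ true ×-dec s ((p ⊕ d) ⊕ d) Bool.≟ false)
  where
  Conditions : Set
  Conditions = OnBoard p × OnBoard (p ⊕ d) × OnBoard ((p ⊕ d) ⊕ d)
             × s p ≡ true × s (p ⊕ d) ≡ true × s ((p ⊕ d) ⊕ d) ≡ false
  toJump : Conditions → Jump s p d (after s p d)
  toJump (onP , onMid , onTo , pegP , pegMid , empty) = record
    { onP = onP ; onMid = onMid ; onTo = onTo ; pegP = pegP ; pegMid = pegMid ; empty = empty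
    ; result = λ _ _ → refl }
  fromJump : Jump s p d (after s p d) → Conditions
  fromJump J = let open Jump J in onP , onMid , onTo , pegP , pegMid , empty

replay : ∀ s → List (Cell × Dir) → Maybe (Play s finishState)
replay s []             =
  Maybe.map (done ∘ board≡⇒≈) (dec⇒maybe (board s ≟B board finishState))
replay s ((c , d) ∷ js) =
  Maybe.zipWith (step (pos c) d) (dec⇒maybe (jump? s (pos c) d)) (replay (after s (pos c) d) js)

sevenMoveSolution : Play startState finishState
sevenMoveSolution = from-just (replay startState
  ((c1 , N) ∷ (c4 , S) ∷ (a3 , E) ∷ (d3 , W) ∷ (e3 , SW) ∷ (c1 , N) ∷
   (b4 , SE) ∷ (c5 , SE) ∷ (e3 , SW) ∷ (c1 , NW) ∷ (a3 , E) ∷ []))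

mainTheorem4 : Play startState finishState
    × Σ (Play startState finishState) (λ sol → moves sol ≡ 7)
    × ((sol : Play startState finishState) → 7 ≤ moves sol)
mainTheorem4 =
  sevenMoveSolution , (sevenMoveSolution , refl) , unfinishable⇒moves> 12 6 sixMovesUnfinishable
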